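{- Let $\mathcal A=\langle A;\Xi\rangle$ be an algebra where $\Xi$ contains a group operation. (1) Every $\mathcal A$-stable preorder with finite index is an $\mathcal A$-congruence. (2) A function $f\colon A\to A$ preserves all finite index $\mathcal A$-stable preorders if and only if it preserves all finite index $\mathcal A$-congruences; consequently the following four conditions are equivalent: $f$ preserves all finite index $\mathcal A$-stable preorders; $f$ preserves all finite index $\mathcal A$-congruences; $f^{ -1}(L)\in\mathrm{Latt}^{\emptyset,A}_{\mathcal A}(L)$ for every $\mathcal A$-recognizable $L\subseteq A$; $f^{ -1}(L)\in\mathrm{Bool}^{\emptyset,A}_{\mathcal A}(L)$ for every $\mathcal A$-recognizable $L\subseteq A$. (3) If $L\subseteq A$ is $\mathcal A$-recognizable then its syntactic preorder $\preceq_L$ equals its syntactic congruence $\sim_L$, $\mathrm{Latt}^{\emptyset,A}_{\mathcal A}(L)=\mathrm{Latt}^{\infty}_{\mathcal A}(L)$ and $\mathrm{Bool}^{\emptyset,A}_{\mathcal A}(L)=\mathrm{Bool}^{\infty}_{\mathcal A}(L)$.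
   Context: A group operation is a binary operation in $\Xi$ making $A$ a group. A relation is $\mathcal A$-stable if compatible with every operation of $\Xi$ (arguments pairwise related imply values related); congruences are stable equivalences, stable preorders are stable reflexive transitive relations; the index of a congruence is its number of classes; the index of a stable preorder $\sqsubseteq$ is that of $\{(x,y):x\sqsubseteq y,y\sqsubseteq x\}$; $f$ preserves $\rho$ if $x\rho y\Rightarrow f(x)\rho f(y)$. $L$ is $\mathcal A$-recognizable if it is a union of classes of a finite index congruence. The 1-freezifications of an operation $\xi$ of arity $n\ge2$ are the maps $x\mapsto\xi(c_1,\dots,c_{i-1},x,c_{i+1},\dots,c_n)$ with $c_j\in A$; a unary operation is its own 1-freezification; $\mathrm{Freez}^*(\mathcal A)$ is the set of finite (possibly empty) compositions of 1-freezifications. $x\preceq_L y$ iff $\gamma(y)\in L\Rightarrow\gamma(x)\in L$ for all $\gamma\in\mathrm{Freez}^*(\mathcal A)$; $x\sim_L y$ iff $\gamma(y)\in L\Leftrightarrow\gamma(x)\in L$ for all such $\gamma$. $\mathrm{Latt}^{\emptyset,A}_{\mathcal A}(L)$ (resp. $\mathrm{Bool}^{\emptyset,A}_{\mathcal A}(L)$) is the smallest family of subsets of $A$ containing $L,\emptyset,A$ closed under finite unions and intersections (resp. and complementation) and under $X\mapsto\gamma^{ -1}(X)$ for all $\gamma\in\mathrm{Freez}^*(\mathcal A)$; $\mathrm{Latt}^{\infty}_{\mathcal A}(L)$ (resp. $\mathrm{Bool}^{\infty}_{\mathcal A}(L)$) is the smallest family containing $L$ closed under arbitrary unions and intersections (resp.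 and complementation) and all $\gamma^{ -1}$. -}

module Defs where

open import Level using (Level; 0ℓ) renaming (suc to lsuc)
open import Data.Nat using (ℕ; _≤_)
open import Data.Fin using (Fin)
open import Data.Product using (Σ; _×_; _,_; ∃)
open import Data.Sum using (_⊎_)
open import Data.Empty using (⊥)
open import Data.Unit using (⊤)
open import Data.List using (List; []; _∷_)
open import Data.Vec.Functional using (updateAt) renaming (_∷_ to _∷ᵛ_; [] to []ᵛ)
open import Relation.Nullary using (¬_)
open import Relation.Binary.PropositionalEquality using (_≡_; subst)
open import Relation.Binary.Core using (Rel)
open import Relation.Binary.Definitions using (Reflexive; Transitive)
open import Relation.Binary.Structures using (IsEquivalence)
open import Algebra.Structures using (IsGroup)
open import Function using (_∘_; id)
open import Function.Bundles using (_⇔_)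

record Algebra : Set₁ where
  field
    Carrier : Set
    Op      : Set
    arity   : Op → ℕ
    ⟦_⟧     : (ξ : Op) → (Fin (arity ξ) → Carrier) → Carrier

Subset : Set → Set₁
Subset A = A → Set

module _ (𝒜 : Algebra) where
  open Algebra 𝒜

  private
    A = Carrier

  binOp : (ξ : Op) → arity ξ ≡ 2 → A → A → A
  binOp ξ p x y = ⟦ ξ ⟧ ((x ∷ᵛ y ∷ᵛ []ᵛ) ∘ subst Fin p)

  IsGroupOperation : Op → Set
  IsGroupOperation ξ =
    Σ (arity ξ ≡ 2) λ p → Σ A λ e → Σ (A → A) λ inv →
      IsGroup _≡_ (binOp ξ p) e inv

  HasGroupOperation : Set
  HasGroupOperation = Σ Op IsGroupOperation

  Stable : Rel A 0ℓ → Set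
  Stable R = ∀ (ξ : Op) (xs ys : Fin (arity ξ) → A) →
    (∀ i → R (xs i) (ys i)) → R (⟦ ξ ⟧ xs) (⟦ ξ ⟧ ys)

  IsCongruence : Rel A 0ℓ → Set
  IsCongruence R = IsEquivalence R × Stable R

  IsStablePreorder : Rel A 0ℓ → Set
  IsStablePreorder R = Reflexive R × Transitive R × Stable R

  FiniteIndex : Rel A 0ℓ → Set
  FiniteIndex E = Σ ℕ λ n → Σ (Fin n → A) λ r → ∀ x → Σ (Fin n) λ i → E x (r i)

  kernel : Rel A 0ℓ → Rel A 0ℓ
  kernel R x y = R x y × R y x

  PreorderFiniteIndex : Rel A 0ℓ → Set
  PreorderFiniteIndex R = FiniteIndex (kernel R)

  FiniteIndexCongruence : Rel A 0ℓ → Set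
  FiniteIndexCongruence R = IsCongruence R × FiniteIndex R

  FiniteIndexStablePreorder : Rel A 0ℓ → Set
  FiniteIndexStablePreorder R = IsStablePreorder R × PreorderFiniteIndex R

  Preserves : (A → A) → Rel A 0ℓ → Set
  Preserves f R = ∀ x y → R x y → R (f x) (f y)

  PreservesAllFIStablePreorders : (A → A) → Set₁
  PreservesAllFIStablePreorders f =
    ∀ (R : Rel A 0ℓ) → FiniteIndexStablePreorder R → Preserves f R

  PreservesAllFICongruences : (A → A) → Set₁
  PreservesAllFICongruences f =
    ∀ (R : Rel A 0ℓ) → FiniteIndexCongruence R → Preserves f R

  UnionOfClasses : Rel A 0ℓ → Subset A → Set
  UnionOfClasses R L = ∀ x y → R x y → L x → L y

  Recognizable : Subset A → Set₁
  Recognizable L = Σ (Rel A 0ℓ) λ R → FiniteIndexCongruence R × UnionOfClasses R L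

  data Freez1 : Set where
    unary : (ξ : Op) → arity ξ ≡ 1 → Freez1
    multi : (ξ : Op) → 2 ≤ arity ξ → (i : Fin (arity ξ)) → (c : Fin (arity ξ) → A) → Freez1

  ⟦_⟧₁ : Freez1 → A → A
  ⟦ unary ξ _ ⟧₁ x = ⟦ ξ ⟧ (λ _ → x)
  ⟦ multi ξ _ i c ⟧₁ x = ⟦ ξ ⟧ (updateAt c i (λ _ → x))

  Freez* : Set
  Freez* = List Freez1

  ⟦_⟧* : Freez* → A → A
  ⟦ [] ⟧* = id
  ⟦ γ ∷ γs ⟧* = ⟦ γ ⟧₁ ∘ ⟦ γs ⟧*

  SyntPreorder : Subset A → Rel A 0ℓ
  SyntPreorder L x y = ∀ (γ : Freez*) → L (⟦ γ ⟧* y) → L (⟦ γ ⟧* x)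

  SyntCongruence : Subset A → Rel A 0ℓ
  SyntCongruence L x y = ∀ (γ : Freez*) → L (⟦ γ ⟧* y) ⇔ L (⟦ γ ⟧* x)

  _⁻¹[_] : (A → A) → Subset A → Subset A
  (g ⁻¹[ X ]) x = X (g x)

  -- Families are closed under extensional equality of subsets, since
  -- subsets are represented by predicates.
  _≐_ : Subset A → Subset A → Set
  X ≐ Y = ∀ x → X x ⇔ Y x

  data Latt∅A (L : Subset A) : Subset A → Set₁ where
    base  : Latt∅A L L
    empty : Latt∅A L (λ _ → ⊥)
    full  : Latt∅A L (λ _ → ⊤)
    union : ∀ {X Y} → Latt∅A L X → Latt∅A L Y → Latt∅A L (λ x → X x ⊎ Y x)
    inter : ∀ {X Y} → Latt∅A L X → Latt∅A L Y → Latt∅A L (λ x → X x × Y x)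
    preim : ∀ {X} (γ : Freez*) → Latt∅A L X → Latt∅A L (⟦ γ ⟧* ⁻¹[ X ])
    ext   : ∀ {X Y} → Latt∅A L X → X ≐ Y → Latt∅A L Y

  data Bool∅A (L : Subset A) : Subset A → Set₁ where
    base  : Bool∅A L L
    empty : Bool∅A L (λ _ → ⊥)
    full  : Bool∅A L (λ _ → ⊤)
    union : ∀ {X Y} → Bool∅A L X → Bool∅A L Y → Bool∅A L (λ x → X x ⊎ Y x)
    inter : ∀ {X Y} → Bool∅A L X → Bool∅A L Y → Bool∅A L (λ x → X x × Y x)
    compl : ∀ {X} → Bool∅A L X → Bool∅A L (λ x → ¬ X x)
    preim : ∀ {X} (γ : Freez*) → Bool∅A L X → Bool∅A L (⟦ γ ⟧* ⁻¹[ X ])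
    ext   : ∀ {X Y} → Bool∅A L X → X ≐ Y → Bool∅A L Y

  data Latt∞ (L : Subset A) : Subset A → Set₁ where
    base  : Latt∞ L L
    union : ∀ {J : Set} (F : J → Subset A) → (∀ j → Latt∞ L (F j)) →
            Latt∞ L (λ x → Σ J λ j → F j x)
    inter : ∀ {J : Set} (F : J → Subset A) → (∀ j → Latt∞ L (F j)) →
            Latt∞ L (λ x → ∀ j → F j x)
    preim : ∀ {X} (γ : Freez*) → Latt∞ L X → Latt∞ L (⟦ γ ⟧* ⁻¹[ X ])
    ext   : ∀ {X Y} → Latt∞ L X → X ≐ Y → Latt∞ L Y

  data Bool∞ (L : Subset A) : Subset A → Set₁ where
    base  : Bool∞ L L
    union : ∀ {J : Set} (F : J → Subset A) → (∀ j → Bool∞ L (F j)) →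
            Bool∞ L (λ x → Σ J λ j → F j x)
    inter : ∀ {J : Set} (F : J → Subset A) → (∀ j → Bool∞ L (F j)) →
            Bool∞ L (λ x → ∀ j → F j x)
    compl : ∀ {X} → Bool∞ L X → Bool∞ L (λ x → ¬ X x)
    preim : ∀ {X} (γ : Freez*) → Bool∞ L X → Bool∞ L (⟦ γ ⟧* ⁻¹[ X ])
    ext   : ∀ {X Y} → Bool∞ L X → X ≐ Y → Bool∞ L Y

{-# OPTIONS --safe #-}
module Submission where

-- In a group, if x ≤ y for a stable preorder then g = x⁻¹y satisfies ε ≤ g, so the
-- powers of g ascend; with finitely many classes two of them are equivalent, which
-- forces g ≤ ε and hence y ≤ x.
--
-- For recognizable L the syntactic preorder ≼ is a finite index stable preorder and
-- the largest freezification-invariant relation under which L is downward closed.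
-- Every member of Latt∞(L), and of Bool∞(L) once ≼ is symmetric, is ≼-downward
-- closed. Conversely, classically, a ≼-downward closed set is the finite union of the
-- downsets of the classes it meets, and each such downset is a finite intersection of
-- sets γ⁻¹(L), one separating it from each other class; so it lies in Latt^{∅,A}(L).
-- This gives (3), and (2) follows because f⁻¹(L) is ≼-downward closed when f
-- preserves ≼, while the classes of a finite index congruence are recognizable.

open import Defs
open import Level using (0ℓ; lift; lower) renaming (suc to lsuc)
open import Data.Product using (Σ; ∃; ∃₂; _×_; _,_; proj₁; proj₂; map₂)
open import Data.Sum using (_⊎_; inj₁; inj₂)
open import Data.Empty using (⊥; ⊥-elim)
open import Data.Unit using (⊤; tt)
open import Data.Bool using (true; false; if_then_else_)
open import Data.Nat using (ℕ; zero; suc; _≤_; _<_; _≤′_; ≤′-refl; ≤′-step; z≤n; s≤s)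
open import Data.Nat.Properties using (≤⇒≤′; n<1+n)
open import Data.Fin using (Fin; zero; suc; toℕ)
open import Data.Fin.Properties using (pigeonhole)
open import Data.List using ([]; _∷_; _++_)
open import Data.Vec.Functional using (updateAt; tail) renaming (_∷_ to _∷ᵛ_; [] to []ᵛ)
open import Data.Vec.Functional.Properties using (updateAt-updates; updateAt-id-local)
open import Data.Vec.Functional.Relation.Binary.Pointwise using (Pointwise)
open import Relation.Nullary using (¬_; yes; no)
open import Relation.Nullary.Decidable using (map′; decidable-stable)
open import Relation.Binary.PropositionalEquality using (_≡_; _≗_; refl; sym; cong; subst; subst₂)
open import Relation.Binary.Core using (Rel; _Preserves₂_⟶_⟶_)
open import Relation.Binary.Definitions using (Reflexive; Symmetric; Transitive)
open import Relation.Binary.Structures using (IsEquivalence)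
open import Algebra.Core using (Op₁; Op₂)
open import Algebra.Bundles using (Group)
open import Algebra.Structures using (IsGroup)
import Algebra.Properties.Group as GroupProperties
open import Function using (_∘_)
open import Function.Bundles using (_⇔_; mk⇔; Equivalence)
open import Axiom.ExcludedMiddle using (ExcludedMiddle)
open Algebra using (Carrier)

lower-excludedMiddle : ExcludedMiddle (lsuc 0ℓ) → ExcludedMiddle 0ℓ
lower-excludedMiddle em = map′ lower lift em

Recurrent : {A : Set} → Rel A 0ℓ → Set
Recurrent {A} R = ∀ (s : ℕ → A) → ∃₂ λ i j → i < j × R (s j) (s i)

module _ {A : Set} {_∙_ : Op₂ A} {ε : A} {_⁻¹ : Op₁ A} (isGroup : IsGroup _≡_ _∙_ ε _⁻¹)
         {R : Rel A 0ℓ} (R-refl : Reflexive R) (R-trans : Transitive R)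
         (∙-mono : _∙_ Preserves₂ R ⟶ R ⟶ R) where

  private
    group : Group 0ℓ 0ℓ
    group = record { Carrier = A ; _≈_ = _≡_ ; _∙_ = _∙_ ; ε = ε ; _⁻¹ = _⁻¹ ; isGroup = isGroup }
    open IsGroup isGroup using (identityˡ; identityʳ; inverseˡ; inverseʳ)
    open GroupProperties group using (\\-leftDividesˡ; //-rightDividesʳ)

  _^_ : A → ℕ → A
  g ^ zero = ε
  g ^ suc k = g ∙ (g ^ k)

  powers-ascending : ∀ {g i j} → R ε g → i ≤′ j → R (g ^ i) (g ^ j)
  powers-ascending ε≤g ≤′-refl = R-refl
  powers-ascending ε≤g (≤′-step i≤j) =
    R-trans (powers-ascending ε≤g i≤j) (subst₂ R (identityˡ _) refl (∙-mono ε≤g R-refl))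

  recurrent⇒symmetric : Recurrent R → Symmetric R
  recurrent⇒symmetric recurrent {x} {y} x≤y =
    subst₂ R (\\-leftDividesˡ x y) (identityʳ x) (∙-mono (R-refl {x}) g≤ε)
    where
    g : A
    g = (x ⁻¹) ∙ y

    ε≤g : R ε g
    ε≤g = subst₂ R (inverseˡ x) refl (∙-mono R-refl x≤y)

    -- For the recurring pair i < j, g ∙ gⁱ ≤ gʲ ≤ gⁱ; now cancel gⁱ on the right.
    g≤ε : R g ε
    g≤ε with i , j , i<j , gʲ≤gⁱ ← recurrent (g ^_) =
      subst₂ R (//-rightDividesʳ (g ^ i) g) (inverseʳ (g ^ i))
        (∙-mono (R-trans (powers-ascending ε≤g (≤⇒≤′ i<j)) gʲ≤gⁱ) (R-refl {(g ^ i) ⁻¹}))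

updateAt⁺ : ∀ {A : Set} {R : Rel A 0ℓ} → Reflexive R → ∀ {n} (c : Fin n → A) i {x y} → R x y →
            Pointwise R (updateAt c i (λ _ → x)) (updateAt c i (λ _ → y))
updateAt⁺ R-refl c zero    x≤y zero    = x≤y
updateAt⁺ R-refl c zero    x≤y (suc j) = R-refl
updateAt⁺ R-refl c (suc i) x≤y zero    = R-refl
updateAt⁺ {R = R} R-refl c (suc i) x≤y (suc j) = updateAt⁺ {R = R} R-refl (tail c) i x≤y j

-- The hybrid argument: change the coordinates one at a time.
pointwise-by-updates : ∀ {A : Set} {P : Rel A 0ℓ} {n} (T : Rel (Fin n → A) 0ℓ) →
  Transitive T → (∀ {zs ws} → zs ≗ ws → T zs ws) →
  (∀ zs i {y} → P (zs i) y → T zs (updateAt zs i (λ _ → y))) →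
  ∀ {xs ys} → Pointwise P xs ys → T xs ys
pointwise-by-updates {n = zero} T T-trans T-≗ T-update xs≤ys = T-≗ (λ ())
pointwise-by-updates {P = P} {n = suc n} T T-trans T-≗ T-update {xs} {ys} xs≤ys =
  T-trans (T-trans (T-update xs zero (xs≤ys zero)) (T-≗ λ { zero → refl ; (suc j) → refl }))
    (T-trans (pointwise-by-updates {P = P} T′ T-trans (T-≗ ∘ ∷-≗) T′-update (xs≤ys ∘ suc))
      (T-≗ λ { zero → refl ; (suc j) → refl }))
  where
  T′ : Rel (Fin n → _) 0ℓ
  T′ zs ws = T (ys zero ∷ᵛ zs) (ys zero ∷ᵛ ws)

  ∷-≗ : ∀ {zs ws} → zs ≗ ws → (ys zero ∷ᵛ zs) ≗ (ys zero ∷ᵛ ws)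
  ∷-≗ zs≗ws zero    = refl
  ∷-≗ zs≗ws (suc j) = zs≗ws j

  T′-update : ∀ zs i {y} → P (zs i) y → T′ zs (updateAt zs i (λ _ → y))
  T′-update zs i z≤y =
    T-trans (T-update (ys zero ∷ᵛ zs) (suc i) z≤y) (T-≗ λ { zero → refl ; (suc j) → refl })

one-or-many : ∀ {n} → Fin n → n ≡ 1 ⊎ 2 ≤ n
one-or-many {suc zero}    _ = inj₁ refl
one-or-many {suc (suc n)} _ = inj₂ (s≤s (s≤s z≤n))

Fin1-≗ : ∀ {A : Set} {n} {f g : Fin n → A} → n ≡ 1 → ∀ i → f i ≡ g i → f ≗ g
Fin1-≗ refl zero fi≡gi zero = fi≡gi

module _ (𝒜 : Algebra) where
  open Algebra 𝒜 using (Op; arity; ⟦_⟧)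

  private
    A : Set
    A = Carrier 𝒜

  DownClosed : Rel A 0ℓ → Subset A → Set
  DownClosed R X = ∀ {x y} → R x y → X y → X x

  PreservedByFreez : Rel A 0ℓ → Set
  PreservedByFreez R = ∀ φ → Preserves 𝒜 (⟦_⟧₁ 𝒜 φ) R

  finiteIndex-mono : ∀ {E E′ : Rel A 0ℓ} → (∀ {x y} → E x y → E′ x y) →
                     FiniteIndex 𝒜 E → FiniteIndex 𝒜 E′
  finiteIndex-mono E⊆E′ (n , r , class) = n , r , map₂ E⊆E′ ∘ class

  finiteIndex⇒recurrent : ∀ {R} → Transitive R → PreorderFiniteIndex 𝒜 R → Recurrent R
  finiteIndex⇒recurrent {R} R-trans (n , r , class) s
    with i , j , i<j , same-class ← pigeonhole (n<1+n n) (proj₁ ∘ class ∘ s ∘ toℕ) =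
    toℕ i , toℕ j , i<j ,
    R-trans (proj₁ (proj₂ (class (s (toℕ j)))))
            (subst (λ c → R (r c) (s (toℕ i))) same-class (proj₂ (proj₂ (class (s (toℕ i))))))

  stable⇒binOp-mono : ∀ {R ξ} (p : arity ξ ≡ 2) → Stable 𝒜 R → binOp 𝒜 ξ p Preserves₂ R ⟶ R ⟶ R
  stable⇒binOp-mono {R} {ξ} p R-stable {x} {x′} {y} {y′} x≤x′ y≤y′ =
    R-stable ξ _ _ (both ∘ subst Fin p)
    where
    both : Pointwise R (x ∷ᵛ y ∷ᵛ []ᵛ) (x′ ∷ᵛ y′ ∷ᵛ []ᵛ)
    both zero       = x≤x′
    both (suc zero) = y≤y′

  finiteIndexStablePreorder⇒congruence : HasGroupOperation 𝒜 → ∀ {R} →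
    FiniteIndexStablePreorder 𝒜 R → IsCongruence 𝒜 R
  finiteIndexStablePreorder⇒congruence (_ , p , _ , _ , isGroup) {R}
    ((R-refl , R-trans , R-stable) , R-finite) =
    record { refl = R-refl ; sym = R-sym ; trans = R-trans } , R-stable
    where
    R-sym : Symmetric R
    R-sym = recurrent⇒symmetric isGroup {R = R} R-refl R-trans (stable⇒binOp-mono {R} p R-stable)
              (finiteIndex⇒recurrent R-trans R-finite)

  congruence⇒stablePreorder : ∀ {R} → FiniteIndexCongruence 𝒜 R → FiniteIndexStablePreorder 𝒜 R
  congruence⇒stablePreorder {R} ((R-equiv , R-stable) , R-finite) =
    (R-refl , R-trans , R-stable) , finiteIndex-mono {E′ = kernel 𝒜 R} (λ r → r , R-sym r) R-finite
    where
    open IsEquivalence R-equiv renaming (refl to R-refl; sym to R-sym; trans to R-trans)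

  stablePreorder⇒congruence : HasGroupOperation 𝒜 → ∀ {R} →
    FiniteIndexStablePreorder 𝒜 R → FiniteIndexCongruence 𝒜 R
  stablePreorder⇒congruence G {R} R-fisp@(_ , R-finite) =
    finiteIndexStablePreorder⇒congruence G R-fisp , finiteIndex-mono {kernel 𝒜 R} {R} proj₁ R-finite

  stable⇒preservedByFreez : ∀ {R} → Reflexive R → Stable 𝒜 R → PreservedByFreez R
  stable⇒preservedByFreez {R} R-refl R-stable (unary ξ _) x y x≤y = R-stable ξ _ _ (λ _ → x≤y)
  stable⇒preservedByFreez {R} R-refl R-stable (multi ξ _ i c) x y x≤y =
    R-stable ξ _ _ (updateAt⁺ {R = R} R-refl c i x≤y)

  stable⇒respects-≗ : ∀ {R} → Reflexive R → Stable 𝒜 R →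
                      ∀ ξ {xs ys} → xs ≗ ys → R (⟦ ξ ⟧ xs) (⟦ ξ ⟧ ys)
  stable⇒respects-≗ {R} R-refl R-stable ξ {xs} xs≗ys =
    R-stable ξ _ _ (λ i → subst (R (xs i)) (xs≗ys i) R-refl)

  freez*-preserves : ∀ {R} → PreservedByFreez R → ∀ γ → Preserves 𝒜 (⟦_⟧* 𝒜 γ) R
  freez*-preserves R-freez []      x y x≤y = x≤y
  freez*-preserves R-freez (φ ∷ γ) x y x≤y = R-freez φ _ _ (freez*-preserves R-freez γ x y x≤y)

  -- A single coordinate i of ξ can be changed by a 1-freezification: the unary
  -- operation ξ itself if ξ has arity 1, and x ↦ ξ(zs with x at i) otherwise.
  preservedByFreez⇒stable : ∀ {R} → Transitive R →
    (∀ ξ {xs ys} → xs ≗ ys → R (⟦ ξ ⟧ xs) (⟦ ξ ⟧ ys)) → PreservedByFreez R → Stable 𝒜 R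
  preservedByFreez⇒stable {R} R-trans R-≗ R-freez ξ xs ys =
    pointwise-by-updates {P = R} (λ zs ws → R (⟦ ξ ⟧ zs) (⟦ ξ ⟧ ws)) R-trans (R-≗ ξ) update
    where
    update : ∀ zs i {y} → R (zs i) y → R (⟦ ξ ⟧ zs) (⟦ ξ ⟧ (updateAt zs i (λ _ → y)))
    update zs i zᵢ≤y with one-or-many i
    ... | inj₁ arity≡1 =
      R-trans (R-≗ ξ (Fin1-≗ arity≡1 i refl))
        (R-trans (R-freez (unary ξ arity≡1) _ _ zᵢ≤y)
          (R-≗ ξ (Fin1-≗ arity≡1 i (sym (updateAt-updates i zs)))))
    ... | inj₂ 2≤arity =
      R-trans (R-≗ ξ (λ j → sym (updateAt-id-local i zs refl j)))
        (R-freez (multi ξ 2≤arity i zs) _ _ zᵢ≤y)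

  ⟦++⟧* : ∀ γ δ x → ⟦_⟧* 𝒜 (γ ++ δ) x ≡ ⟦_⟧* 𝒜 γ (⟦_⟧* 𝒜 δ x)
  ⟦++⟧* []      δ x = refl
  ⟦++⟧* (φ ∷ γ) δ x = cong (⟦_⟧₁ 𝒜 φ) (⟦++⟧* γ δ x)

  congruence-class-recognizable : ∀ {R} → FiniteIndexCongruence 𝒜 R →
                                  ∀ a → Recognizable 𝒜 (λ z → R z a)
  congruence-class-recognizable {R} R-fic@((R-equiv , _) , _) a =
    R , R-fic , λ z z′ z~z′ z~a → R-trans (R-sym z~z′) z~a
    where
    open IsEquivalence R-equiv renaming (sym to R-sym; trans to R-trans)

  module BinaryClosure (𝓕 : Subset A → Set₁)
    (⋃-closed : ∀ {J : Set} (F : J → Subset A) → (∀ j → 𝓕 (F j)) → 𝓕 (λ x → Σ J λ j → F j x))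
    (⋂-closed : ∀ {J : Set} (F : J → Subset A) → (∀ j → 𝓕 (F j)) → 𝓕 (λ x → ∀ j → F j x))
    (≐-closed : ∀ {X Y} → 𝓕 X → _≐_ 𝒜 X Y → 𝓕 Y) where

    ∅-closed : 𝓕 (λ _ → ⊥)
    ∅-closed = ≐-closed (⋃-closed {J = ⊥} (λ ()) (λ ())) (λ x → mk⇔ (λ ()) (λ ()))

    full-closed : 𝓕 (λ _ → ⊤)
    full-closed = ≐-closed (⋂-closed {J = ⊥} (λ ()) (λ ())) (λ x → mk⇔ (λ _ → tt) (λ _ ()))

    ∪-closed : ∀ {X Y} → 𝓕 X → 𝓕 Y → 𝓕 (λ x → X x ⊎ Y x)
    ∪-closed {X} {Y} X∈ Y∈ =
      ≐-closed (⋃-closed (λ b → if b then X else Y) (λ { true → X∈ ; false → Y∈ }))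
        (λ x → mk⇔ (λ { (true , Xx) → inj₁ Xx ; (false , Yx) → inj₂ Yx })
                   (λ { (inj₁ Xx) → true , Xx ; (inj₂ Yx) → false , Yx }))

    ∩-closed : ∀ {X Y} → 𝓕 X → 𝓕 Y → 𝓕 (λ x → X x × Y x)
    ∩-closed {X} {Y} X∈ Y∈ =
      ≐-closed (⋂-closed (λ b → if b then X else Y) (λ { true → X∈ ; false → Y∈ }))
        (λ x → mk⇔ (λ XYx → XYx true , XYx false)
                   (λ { (Xx , Yx) true → Xx ; (Xx , Yx) false → Yx }))

  module _ (L : Subset A) where

    private
      _≼_ : Rel A 0ℓ
      _≼_ = SyntPreorder 𝒜 L

    ≼-refl : Reflexive _≼_
    ≼-refl γ Lγx = Lγx

    ≼-trans : Transitive _≼_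
    ≼-trans x≼y y≼z γ = x≼y γ ∘ y≼z γ

    ≼-freez : PreservedByFreez _≼_
    ≼-freez φ x y x≼y γ =
      subst L (⟦++⟧* γ (φ ∷ []) x) ∘ x≼y (γ ++ φ ∷ []) ∘ subst L (sym (⟦++⟧* γ (φ ∷ []) y))

    L-downClosed : DownClosed _≼_ L
    L-downClosed x≼y = x≼y []

    ⊆SyntPreorder : ∀ {R} → PreservedByFreez R → DownClosed R L → ∀ {x y} → R x y → x ≼ y
    ⊆SyntPreorder R-freez L-dc {x} {y} x≤y γ = L-dc (freez*-preserves R-freez γ x y x≤y)

    recognizable⇒SyntPreorder-FISP : Recognizable 𝒜 L → FiniteIndexStablePreorder 𝒜 _≼_
    recognizable⇒SyntPreorder-FISP (E , ((E-equiv , E-stable) , E-finite) , L-saturated) =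
      (≼-refl , ≼-trans , ≼-stable) ,
      finiteIndex-mono {E} {kernel 𝒜 _≼_} (λ e → E⊆≼ e , E⊆≼ (E-sym e)) E-finite
      where
      open IsEquivalence E-equiv renaming (refl to E-refl; sym to E-sym)

      E⊆≼ : ∀ {x y} → E x y → x ≼ y
      E⊆≼ = ⊆SyntPreorder (stable⇒preservedByFreez E-refl E-stable) (L-saturated _ _ ∘ E-sym)

      ≼-stable : Stable 𝒜 _≼_
      ≼-stable =
        preservedByFreez⇒stable ≼-trans (λ ξ → E⊆≼ ∘ stable⇒respects-≗ {E} E-refl E-stable ξ) ≼-freez

    SyntPreorder⇔SyntCongruence : Symmetric _≼_ → ∀ x y → x ≼ y ⇔ SyntCongruence 𝒜 L x y
    SyntPreorder⇔SyntCongruence ≼-sym x y =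
      mk⇔ (λ x≼y γ → mk⇔ (x≼y γ) (≼-sym x≼y γ)) (λ x~y γ → Equivalence.to (x~y γ))

    private
      module Latt∞-closure = BinaryClosure (Latt∞ 𝒜 L) union inter ext
      module Bool∞-closure = BinaryClosure (Bool∞ 𝒜 L) union inter ext

    Latt∅A⊆Bool∅A : ∀ {X} → Latt∅A 𝒜 L X → Bool∅A 𝒜 L X
    Latt∅A⊆Bool∅A base          = base
    Latt∅A⊆Bool∅A empty         = empty
    Latt∅A⊆Bool∅A full          = full
    Latt∅A⊆Bool∅A (union X∈ Y∈) = union (Latt∅A⊆Bool∅A X∈) (Latt∅A⊆Bool∅A Y∈)
    Latt∅A⊆Bool∅A (inter X∈ Y∈) = inter (Latt∅A⊆Bool∅A X∈) (Latt∅A⊆Bool∅A Y∈)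
    Latt∅A⊆Bool∅A (preim γ X∈)  = preim γ (Latt∅A⊆Bool∅A X∈)
    Latt∅A⊆Bool∅A (ext X∈ X≐Y)  = ext (Latt∅A⊆Bool∅A X∈) X≐Y

    Latt∅A⊆Latt∞ : ∀ {X} → Latt∅A 𝒜 L X → Latt∞ 𝒜 L X
    Latt∅A⊆Latt∞ base          = base
    Latt∅A⊆Latt∞ empty         = Latt∞-closure.∅-closed
    Latt∅A⊆Latt∞ full          = Latt∞-closure.full-closed
    Latt∅A⊆Latt∞ (union X∈ Y∈) = Latt∞-closure.∪-closed (Latt∅A⊆Latt∞ X∈) (Latt∅A⊆Latt∞ Y∈)
    Latt∅A⊆Latt∞ (inter X∈ Y∈) = Latt∞-closure.∩-closed (Latt∅A⊆Latt∞ X∈) (Latt∅A⊆Latt∞ Y∈)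
    Latt∅A⊆Latt∞ (preim γ X∈)  = preim γ (Latt∅A⊆Latt∞ X∈)
    Latt∅A⊆Latt∞ (ext X∈ X≐Y)  = ext (Latt∅A⊆Latt∞ X∈) X≐Y

    Bool∅A⊆Bool∞ : ∀ {X} → Bool∅A 𝒜 L X → Bool∞ 𝒜 L X
    Bool∅A⊆Bool∞ base          = base
    Bool∅A⊆Bool∞ empty         = Bool∞-closure.∅-closed
    Bool∅A⊆Bool∞ full          = Bool∞-closure.full-closed
    Bool∅A⊆Bool∞ (union X∈ Y∈) = Bool∞-closure.∪-closed (Bool∅A⊆Bool∞ X∈) (Bool∅A⊆Bool∞ Y∈)
    Bool∅A⊆Bool∞ (inter X∈ Y∈) = Bool∞-closure.∩-closed (Bool∅A⊆Bool∞ X∈) (Bool∅A⊆Bool∞ Y∈)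
    Bool∅A⊆Bool∞ (compl X∈)    = compl (Bool∅A⊆Bool∞ X∈)
    Bool∅A⊆Bool∞ (preim γ X∈)  = preim γ (Bool∅A⊆Bool∞ X∈)
    Bool∅A⊆Bool∞ (ext X∈ X≐Y)  = ext (Bool∅A⊆Bool∞ X∈) X≐Y

    module _ {R} (R-freez : PreservedByFreez R) (L-dc : DownClosed R L) where

      Latt∞-downClosed : ∀ {X} → Latt∞ 𝒜 L X → DownClosed R X
      Latt∞-downClosed base                   = L-dc
      Latt∞-downClosed (union F F∈) x≤y (j , Fⱼy) = j , Latt∞-downClosed (F∈ j) x≤y Fⱼy
      Latt∞-downClosed (inter F F∈) x≤y Fy j  = Latt∞-downClosed (F∈ j) x≤y (Fy j)
      Latt∞-downClosed (preim γ X∈) x≤y       =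
        Latt∞-downClosed X∈ (freez*-preserves R-freez γ _ _ x≤y)
      Latt∞-downClosed (ext X∈ X≐Y) {x} {y} x≤y =
        Equivalence.to (X≐Y x) ∘ Latt∞-downClosed X∈ x≤y ∘ Equivalence.from (X≐Y y)

      Bool∞-downClosed : Symmetric R → ∀ {X} → Bool∞ 𝒜 L X → DownClosed R X
      Bool∞-downClosed R-sym base                   = L-dc
      Bool∞-downClosed R-sym (union F F∈) x≤y (j , Fⱼy) = j , Bool∞-downClosed R-sym (F∈ j) x≤y Fⱼy
      Bool∞-downClosed R-sym (inter F F∈) x≤y Fy j  = Bool∞-downClosed R-sym (F∈ j) x≤y (Fy j)
      Bool∞-downClosed R-sym (compl X∈) x≤y ¬Xy Xx  = ¬Xy (Bool∞-downClosed R-sym X∈ (R-sym x≤y) Xx)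
      Bool∞-downClosed R-sym (preim γ X∈) x≤y       =
        Bool∞-downClosed R-sym X∈ (freez*-preserves R-freez γ _ _ x≤y)
      Bool∞-downClosed R-sym (ext X∈ X≐Y) {x} {y} x≤y =
        Equivalence.to (X≐Y x) ∘ Bool∞-downClosed R-sym X∈ x≤y ∘ Equivalence.from (X≐Y y)

    Latt∅A-downClosed : ∀ {X} → Latt∅A 𝒜 L X → DownClosed _≼_ X
    Latt∅A-downClosed = Latt∞-downClosed ≼-freez L-downClosed ∘ Latt∅A⊆Latt∞

    ⋃-Fin : ∀ {n} (F : Fin n → Subset A) → (∀ i → Latt∅A 𝒜 L (F i)) →
            Latt∅A 𝒜 L (λ x → Σ (Fin n) λ i → F i x)
    ⋃-Fin {zero}  F F∈ = ext empty (λ x → mk⇔ (λ ()) (λ ()))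
    ⋃-Fin {suc n} F F∈ = ext (union (F∈ zero) (⋃-Fin (F ∘ suc) (F∈ ∘ suc)))
      (λ x → mk⇔ (λ { (inj₁ F₀x) → zero , F₀x ; (inj₂ (i , Fᵢ₊₁x)) → suc i , Fᵢ₊₁x })
                 (λ { (zero , F₀x) → inj₁ F₀x ; (suc i , Fᵢ₊₁x) → inj₂ (i , Fᵢ₊₁x) }))

    ⋂-Fin : ∀ {n} (F : Fin n → Subset A) → (∀ i → Latt∅A 𝒜 L (F i)) →
            Latt∅A 𝒜 L (λ x → ∀ i → F i x)
    ⋂-Fin {zero}  F F∈ = ext full (λ x → mk⇔ (λ _ ()) (λ _ → tt))
    ⋂-Fin {suc n} F F∈ = ext (inter (F∈ zero) (⋂-Fin (F ∘ suc) (F∈ ∘ suc)))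
      (λ x → mk⇔ (λ { (F₀x , Fx) zero → F₀x ; (F₀x , Fx) (suc i) → Fx i })
                 (λ Fx → Fx zero , Fx ∘ suc))

    module _ (em : ExcludedMiddle 0ℓ) where

      Latt∅A-guard : (Q : Set) → ∀ {X} → Latt∅A 𝒜 L X → Latt∅A 𝒜 L (λ x → Q × X x)
      Latt∅A-guard Q X∈ with em {Q}
      ... | yes q  = ext X∈ (λ x → mk⇔ (q ,_) proj₂)
      ... | no ¬q = ext empty (λ x → mk⇔ (λ ()) (¬q ∘ proj₁))

      -- Either some γ has γ(b) ∈ L but γ(a) ∉ L, and then γ⁻¹(L) separates,
      -- or there is none, which classically means a ≼ b, and A will do.
      separating-set : ∀ a b → Σ (Subset A) λ S →
        Latt∅A 𝒜 L S × (∀ {x} → x ≼ b → S x) × (S a → a ≼ b)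
      separating-set a b with em {∃ λ γ → L (⟦_⟧* 𝒜 γ b) × ¬ L (⟦_⟧* 𝒜 γ a)}
      ... | yes (γ , Lγb , ¬Lγa) =
        _ , preim γ base , (λ x≼b → x≼b γ Lγb) , (λ Lγa → ⊥-elim (¬Lγa Lγa))
      ... | no ∄γ =
        _ , full , (λ _ → tt) , (λ _ γ Lγb → decidable-stable em (λ ¬Lγa → ∄γ (γ , Lγb , ¬Lγa)))

      principal-downset : PreorderFiniteIndex 𝒜 _≼_ → ∀ b → Latt∅A 𝒜 L (_≼ b)
      principal-downset (n , r , class) b =
        ext (⋂-Fin S S∈) (λ x → mk⇔ (bounded x) (λ x≼b i → S-⊇downset i x≼b))
        where
        S : Fin n → Subset A
        S i = proj₁ (separating-set (r i) b)

        S∈ : ∀ i → Latt∅A 𝒜 L (S i)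
        S∈ i = proj₁ (proj₂ (separating-set (r i) b))

        S-⊇downset : ∀ i {x} → x ≼ b → S i x
        S-⊇downset i = proj₁ (proj₂ (proj₂ (separating-set (r i) b)))

        S-separates : ∀ i → S i (r i) → r i ≼ b
        S-separates i = proj₂ (proj₂ (proj₂ (separating-set (r i) b)))

        bounded : ∀ x → (∀ i → S i x) → x ≼ b
        bounded x x∈S with k , x≼rₖ , rₖ≼x ← class x =
          ≼-trans x≼rₖ (S-separates k (Latt∅A-downClosed (S∈ k) rₖ≼x (x∈S k)))

      downClosed⇒Latt∅A : PreorderFiniteIndex 𝒜 _≼_ → ∀ {X} → DownClosed _≼_ X → Latt∅A 𝒜 L X
      downClosed⇒Latt∅A ≼-finite@(n , r , class) {X} X-dc =
        ext (⋃-Fin (λ j x → X (r j) × x ≼ r j)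
                   (λ j → Latt∅A-guard (X (r j)) (principal-downset ≼-finite (r j))))
          (λ x → mk⇔ (λ (j , Xrⱼ , x≼rⱼ) → X-dc x≼rⱼ Xrⱼ)
                     (λ Xx → let (k , x≼rₖ , rₖ≼x) = class x in k , X-dc rₖ≼x Xx , x≼rₖ))

      Latt∞⊆Latt∅A : PreorderFiniteIndex 𝒜 _≼_ → ∀ {X} → Latt∞ 𝒜 L X → Latt∅A 𝒜 L X
      Latt∞⊆Latt∅A ≼-finite = downClosed⇒Latt∅A ≼-finite ∘ Latt∞-downClosed ≼-freez L-downClosed

      Bool∞⊆Bool∅A : PreorderFiniteIndex 𝒜 _≼_ → Symmetric _≼_ → ∀ {X} → Bool∞ 𝒜 L X → Bool∅A 𝒜 L X
      Bool∞⊆Bool∅A ≼-finite ≼-sym =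
        Latt∅A⊆Bool∅A ∘ downClosed⇒Latt∅A ≼-finite ∘ Bool∞-downClosed ≼-freez L-downClosed ≼-sym

    recognizable⇒SyntPreorder-symmetric : HasGroupOperation 𝒜 → Recognizable 𝒜 L → Symmetric _≼_
    recognizable⇒SyntPreorder-symmetric G =
      IsEquivalence.sym ∘ proj₁ ∘ finiteIndexStablePreorder⇒congruence G
        ∘ recognizable⇒SyntPreorder-FISP

  module _ (f : A → A) where

    preservesFISP⇒Latt∅A-preimages : ExcludedMiddle 0ℓ → PreservesAllFIStablePreorders 𝒜 f →
      ∀ L → Recognizable 𝒜 L → Latt∅A 𝒜 L (_⁻¹[_] 𝒜 f L)
    preservesFISP⇒Latt∅A-preimages em f-preserves L L-recognizable =
      downClosed⇒Latt∅A L em (proj₂ ≼-fisp)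
        (λ {x} {y} x≼y → L-downClosed L (f-preserves _ ≼-fisp x y x≼y))
      where
      ≼-fisp : FiniteIndexStablePreorder 𝒜 (SyntPreorder 𝒜 L)
      ≼-fisp = recognizable⇒SyntPreorder-FISP L L-recognizable

    Bool∅A-preimages⇒preservesFIC : (∀ L → Recognizable 𝒜 L → Bool∅A 𝒜 L (_⁻¹[_] 𝒜 f L)) →
      PreservesAllFICongruences 𝒜 f
    Bool∅A-preimages⇒preservesFIC preimages R R-fic@((R-equiv , R-stable) , _) x y x~y =
      Bool∞-downClosed ↓fy (stable⇒preservedByFreez R-refl R-stable) R-trans R-sym
        (Bool∅A⊆Bool∞ ↓fy (preimages ↓fy (congruence-class-recognizable R-fic (f y)))) x~y R-refl
      where
      open IsEquivalence R-equiv renaming (refl to R-refl; sym to R-sym; trans to R-trans)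
      ↓fy : Subset A
      ↓fy z = R z (f y)

    module _ (G : HasGroupOperation 𝒜) where

      preservesFISP⇔preservesFIC : PreservesAllFIStablePreorders 𝒜 f ⇔ PreservesAllFICongruences 𝒜 f
      preservesFISP⇔preservesFIC =
        mk⇔ (λ f-preserves R → f-preserves R ∘ congruence⇒stablePreorder)
            (λ f-preserves R → f-preserves R ∘ stablePreorder⇒congruence G)

      Bool∅A-preimages⇒preservesFISP : (∀ L → Recognizable 𝒜 L → Bool∅A 𝒜 L (_⁻¹[_] 𝒜 f L)) →
        PreservesAllFIStablePreorders 𝒜 f
      Bool∅A-preimages⇒preservesFISP =
        Equivalence.from preservesFISP⇔preservesFIC ∘ Bool∅A-preimages⇒preservesFIC

      module _ (em : ExcludedMiddle 0ℓ) where

        preservesFISP⇔Latt∅A-preimages : PreservesAllFIStablePreorders 𝒜 f ⇔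
          (∀ L → Recognizable 𝒜 L → Latt∅A 𝒜 L (_⁻¹[_] 𝒜 f L))
        preservesFISP⇔Latt∅A-preimages =
          mk⇔ (preservesFISP⇒Latt∅A-preimages em)
              (λ preimages → Bool∅A-preimages⇒preservesFISP λ L → Latt∅A⊆Bool∅A L ∘ preimages L)

        preservesFISP⇔Bool∅A-preimages : PreservesAllFIStablePreorders 𝒜 f ⇔
          (∀ L → Recognizable 𝒜 L → Bool∅A 𝒜 L (_⁻¹[_] 𝒜 f L))
        preservesFISP⇔Bool∅A-preimages =
          mk⇔ (λ f-preserves L → Latt∅A⊆Bool∅A L ∘ preservesFISP⇒Latt∅A-preimages em f-preserves L)
              Bool∅A-preimages⇒preservesFISP

proposition5p5 : ExcludedMiddle (lsuc 0ℓ) →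
    (𝒜 : Algebra) → HasGroupOperation 𝒜 →
    -- (1)
    (∀ (R : Rel (Carrier 𝒜) 0ℓ) → FiniteIndexStablePreorder 𝒜 R → IsCongruence 𝒜 R)
    × -- (2)
    (∀ (f : Carrier 𝒜 → Carrier 𝒜) →
      (PreservesAllFIStablePreorders 𝒜 f ⇔ PreservesAllFICongruences 𝒜 f)
      × (PreservesAllFIStablePreorders 𝒜 f
          ⇔ (∀ (L : Subset (Carrier 𝒜)) → Recognizable 𝒜 L → Latt∅A 𝒜 L (_⁻¹[_] 𝒜 f L)))
      × (PreservesAllFIStablePreorders 𝒜 f
          ⇔ (∀ (L : Subset (Carrier 𝒜)) → Recognizable 𝒜 L → Bool∅A 𝒜 L (_⁻¹[_] 𝒜 f L))))
    × -- (3)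
    (∀ (L : Subset (Carrier 𝒜)) → Recognizable 𝒜 L →
      (∀ x y → SyntPreorder 𝒜 L x y ⇔ SyntCongruence 𝒜 L x y)
      × (∀ X → Latt∅A 𝒜 L X ⇔ Latt∞ 𝒜 L X)
      × (∀ X → Bool∅A 𝒜 L X ⇔ Bool∞ 𝒜 L X))
proposition5p5 em 𝒜 G =
    (λ R → finiteIndexStablePreorder⇒congruence 𝒜 G)
  , (λ f → preservesFISP⇔preservesFIC 𝒜 f G
         , preservesFISP⇔Latt∅A-preimages 𝒜 f G em₀
         , preservesFISP⇔Bool∅A-preimages 𝒜 f G em₀)
  , λ L L-recognizable →
        SyntPreorder⇔SyntCongruence 𝒜 L (≼-sym L L-recognizable)
      , (λ X → mk⇔ (Latt∅A⊆Latt∞ 𝒜 L) (Latt∞⊆Latt∅A 𝒜 L em₀ (≼-finite L L-recognizable)))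
      , (λ X → mk⇔ (Bool∅A⊆Bool∞ 𝒜 L)
                   (Bool∞⊆Bool∅A 𝒜 L em₀ (≼-finite L L-recognizable) (≼-sym L L-recognizable)))
  where
  em₀ : ExcludedMiddle 0ℓ
  em₀ = lower-excludedMiddle em

  ≼-finite : ∀ L → Recognizable 𝒜 L → PreorderFiniteIndex 𝒜 (SyntPreorder 𝒜 L)
  ≼-finite L = proj₂ ∘ recognizable⇒SyntPreorder-FISP 𝒜 L

  ≼-sym : ∀ L → Recognizable 𝒜 L → Symmetric (SyntPreorder 𝒜 L)
  ≼-sym L = recognizable⇒SyntPreorder-symmetric 𝒜 L G
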